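{- The graph~$G'$ is $(P_3+P_5)$-free.
   Context: Given an instance of Not-All-Equal 3-Satisfiability with positive literals only (variables $x_1,\ldots,x_n$, clauses $C_1,\ldots,C_m$ of three positive literals), build $G$: adjacent vertices $x_i,\overline{x}_i$ with lists $\{4,5\}$; vertices $C_j,C_j'$ with lists $\{1,2,3\}$; all edges between $\{x_i,\overline{x}_i\}$-vertices and $\{C_j,C_j'\}$-vertices; for each clause $C_j=\{x_g,x_h,x_i\}$ (fixed order) vertices $a_{g,j},a_{h,j},a_{i,j},a_{g,j}',a_{h,j}',a_{i,j}'$ with edges forming paths $x_g-a_{g,j}-C_j$, $x_h-a_{h,j}-C_j$, $x_i-a_{i,j}-C_j$, $\overline{x}_g-a_{g,j}'-C_j'$, $\overline{x}_h-a_{h,j}'-C_j'$, $\overline{x}_i-a_{i,j}'-C_j'$, with lists $\{1,4\}$ for $a_{g,j},a_{g,j}'$, $\{2,4\}$ for $a_{h,j},a_{h,j}'$, $\{3,4\}$ for $a_{i,j},a_{i,j}'$. The graph $G'$ is obtained from $G$ by adding a clique on new vertices $k_1,\ldots,k_5$ and an edge between $k_\ell$ and $u\in V(G)$ if and only if $\ell\notin L(u)$. $P_3+P_5$ is the disjoint union of paths on $3$ and $5$ vertices; $(P_3+P_5)$-free means no induced subgraph isomorphic to it. -}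

module Defs where

open import Data.Nat using (ℕ; suc)
open import Data.Fin using (Fin; toℕ; #_)
open import Data.List using (List; _∷_; [])
open import Data.List.Membership.Propositional using (_∉_)
open import Data.Product using (Σ; _×_)
open import Data.Sum using (_⊎_)
open import Relation.Binary.PropositionalEquality using (_≡_; _≢_)
open import Function.Definitions using (Injective)
open import Function.Bundles using (_⇔_)

-- An instance of positive Not-All-Equal 3-SAT with n variables and m
-- clauses: clause j consists of the variables (cl j 0, cl j 1, cl j 2)
-- (in this fixed order: g, h, i).  The three variables of a clause are
-- required to be distinct (a clause is a set of three literals).

Clauses : ℕ → ℕ → Set
Clauses n m = Fin m → Fin 3 → Fin n

DistinctClauses : ∀ {n m} → Clauses n m → Set
DistinctClauses {n} {m} cl = (j : Fin m) (p q : Fin 3) → p ≢ q → cl j p ≢ cl j q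

-- Vertices of G'.
--   x i, xbar i       : x_i, \overline{x}_i
--   c j, c' j         : C_j, C_j'
--   a j p, a' j p     : a_{v,j}, a_{v,j}' where v = cl j p is the p-th
--                       variable (p = 0,1,2 for g,h,i) of clause C_j
--   k ℓ               : k_{ℓ+1}  (ℓ : Fin 5)

data V (n m : ℕ) : Set where
  x xbar : Fin n → V n m
  c c'   : Fin m → V n m
  a a'   : Fin m → Fin 3 → V n m
  k      : Fin 5 → V n m

data InG {n m : ℕ} : V n m → Set where
  inG-x    : ∀ i → InG (x i)
  inG-xbar : ∀ i → InG (xbar i)
  inG-c    : ∀ j → InG (c j)
  inG-c'   : ∀ j → InG (c' j)
  inG-a    : ∀ j p → InG (a j p)
  inG-a'   : ∀ j p → InG (a' j p)

-- Lists of the vertices of G (colours are 1..5).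
L : ∀ {n m} → V n m → List ℕ
L (x _)     = 4 ∷ 5 ∷ []
L (xbar _)  = 4 ∷ 5 ∷ []
L (c _)     = 1 ∷ 2 ∷ 3 ∷ []
L (c' _)    = 1 ∷ 2 ∷ 3 ∷ []
L (a _ p)   = suc (toℕ p) ∷ 4 ∷ []
L (a' _ p)  = suc (toℕ p) ∷ 4 ∷ []
L (k _)     = []   -- irrelevant: k-vertices are not in G

-- Edges of G' (listed in one orientation; adjacency is the symmetric closure).
data Edge {n m : ℕ} (cl : Clauses n m) : V n m → V n m → Set where
  x-xbar  : ∀ i → Edge cl (x i) (xbar i)
  x-c     : ∀ i j → Edge cl (x i) (c j)
  x-c'    : ∀ i j → Edge cl (x i) (c' j)
  xbar-c  : ∀ i j → Edge cl (xbar i) (c j)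
  xbar-c' : ∀ i j → Edge cl (xbar i) (c' j)
  x-a     : ∀ j p → Edge cl (x (cl j p)) (a j p)
  a-c     : ∀ j p → Edge cl (a j p) (c j)
  xbar-a' : ∀ j p → Edge cl (xbar (cl j p)) (a' j p)
  a'-c'   : ∀ j p → Edge cl (a' j p) (c' j)
  k-k     : ∀ ℓ ℓ' → ℓ ≢ ℓ' → Edge cl (k ℓ) (k ℓ')
  k-G     : ∀ ℓ u → InG u → suc (toℕ ℓ) ∉ L u → Edge cl (k ℓ) u

Adj : ∀ {n m} → Clauses n m → V n m → V n m → Set
Adj cl u v = Edge cl u v ⊎ Edge cl v u

data PEdge : Fin 8 → Fin 8 → Set where
  e01 : PEdge (# 0) (# 1)
  e12 : PEdge (# 1) (# 2)
  e34 : PEdge (# 3) (# 4)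
  e45 : PEdge (# 4) (# 5)
  e56 : PEdge (# 5) (# 6)
  e67 : PEdge (# 6) (# 7)

P3+P5-Adj : Fin 8 → Fin 8 → Set
P3+P5-Adj i j = PEdge i j ⊎ PEdge j i

InducedP3+P5 : {Vt : Set} → (Vt → Vt → Set) → Set
InducedP3+P5 {Vt} Adj' =
  Σ (Fin 8 → Vt) λ f →
    Injective _≡_ _≡_ f ×
    ((i j : Fin 8) → i ≢ j → (Adj' (f i) (f j) ⇔ P3+P5-Adj i j))

module Submission where

-- We prove more: G' contains no "cherry" w₁ – w₂ – w₃ (two edges at w₂ with
-- w₁ ≠ w₃; the edge w₁w₃ is allowed) next to a 5-vertex walk without
-- backtracking all of whose vertices are separated (distinct and
-- non-adjacent) from w₁, w₂ and w₃.  An induced P₃ + P₅ provides both.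

open import Defs
open import Data.Nat using (ℕ)
import Data.Nat as ℕ
import Data.Nat.Properties as ℕ
open import Data.Fin using (Fin; zero; suc; toℕ; #_; _↑ˡ_; _↑ʳ_; _≟_)
open import Data.Fin.Properties using (toℕ-injective; toℕ-↑ˡ)
open import Data.List using (_∷_; [])
open import Data.List.Membership.DecPropositional ℕ._≟_ using (_∈?_; _∉_)
open import Data.List.Relation.Unary.Any using (here; there)
open import Data.Product using (_×_; _,_; proj₁; proj₂)
open import Data.Sum using (_⊎_; inj₁; inj₂; swap)
open import Data.Empty using (⊥; ⊥-elim)
open import Level using (0ℓ)
open import Function using (_∘_)
open import Function.Bundles using (Equivalence)
open import Relation.Nullary using (¬_; yes; no)
open import Relation.Nullary.Decidable using (False; toWitnessFalse)
open import Relation.Unary using (Pred; ∅; _∩_; _⊆_)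
open import Relation.Binary.PropositionalEquality using (_≡_; _≢_; refl; sym; trans)

components-apart : ∀ (i : Fin 3) (j : Fin 5) →
                   i ↑ˡ 5 ≢ 3 ↑ʳ j × ¬ P3+P5-Adj (i ↑ˡ 5) (3 ↑ʳ j)
components-apart zero             j = (λ ()) , λ { (inj₁ ()) ; (inj₂ ()) }
components-apart (suc zero)       j = (λ ()) , λ { (inj₁ ()) ; (inj₂ ()) }
components-apart (suc (suc zero)) j = (λ ()) , λ { (inj₁ ()) ; (inj₂ ()) }

module Walks {V : Set} (_~_ : V → V → Set) (~-sym : ∀ {u v} → u ~ v → v ~ u) where

  Cherry : V → V → V → Set
  Cherry u v w = u ~ v × v ~ w × u ≢ w

  AtMostOneNbr : Pred V 0ℓ → Pred V 0ℓ
  AtMostOneNbr S v = ∀ {u w} → S u → S w → v ~ u → v ~ w → u ≡ w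

  Independent : Pred V 0ℓ → Set
  Independent S = ∀ {u v} → S u → S v → ¬ u ~ v

  InducedMatching : Pred V 0ℓ → Set
  InducedMatching S = ∀ {v} → S v → AtMostOneNbr S v

  PendantOver : Pred V 0ℓ → Pred V 0ℓ → Set
  PendantOver S T = ∀ {v} → S v → T v ⊎ AtMostOneNbr S v

  centre-in : ∀ {S T} → PendantOver S T →
              ∀ {u v w} → Cherry u v w → S u → S v → S w → T v
  centre-in pendant (uv , vw , u≢w) su sv sw with pendant sv
  ... | inj₁ tv     = tv
  ... | inj₂ unique = ⊥-elim (u≢w (unique su sw (~-sym uv) vw))

  no-cherry-in-matching : ∀ {S} → InducedMatching S →
                          ∀ {u v w} → Cherry u v w → S u → S v → S w → ⊥
  no-cherry-in-matching matching = centre-in {T = ∅} (inj₂ ∘ matching)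

  record Walk5 : Set where
    field
      vertex : Fin 5 → V
      bend₁  : Cherry (vertex (# 0)) (vertex (# 1)) (vertex (# 2))
      bend₂  : Cherry (vertex (# 1)) (vertex (# 2)) (vertex (# 3))
      bend₃  : Cherry (vertex (# 2)) (vertex (# 3)) (vertex (# 4))
  open Walk5

  record Inside (S : Pred V 0ℓ) (W : Walk5) : Set where
    constructor inside
    field member : ∀ j → S (vertex W j)
  open Inside

  inside-⊆ : ∀ {S T W} → S ⊆ T → Inside S W → Inside T W
  inside-⊆ S⊆T ins = inside (S⊆T ∘ member ins)

  inside-∩ : ∀ {S T W} → Inside S W → Inside T W → Inside (S ∩ T) W
  inside-∩ insS insT = inside λ j → member insS j , member insT j

  no-walk-in-independent : ∀ {S} → Independent S → ∀ W → ¬ Inside S W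
  no-walk-in-independent independent W ins =
    independent (member ins (# 0)) (member ins (# 1)) (proj₁ (bend₁ W))

  no-walk-in-matching : ∀ {S} → InducedMatching S → ∀ W → ¬ Inside S W
  no-walk-in-matching matching W ins =
    no-cherry-in-matching matching (bend₁ W) (member ins (# 0)) (member ins (# 1)) (member ins (# 2))

  -- pendant vertices hung on an independent set T span stars: the centres v₁, v₂
  -- of the first two bends lie in T, yet are adjacent
  no-walk-in-stars : ∀ {S T} → Independent T → PendantOver S T → ∀ W → ¬ Inside S W
  no-walk-in-stars independent pendant W ins =
    independent (centre-in pendant (bend₁ W) (s (# 0)) (s (# 1)) (s (# 2)))
                (centre-in pendant (bend₂ W) (s (# 1)) (s (# 2)) (s (# 3)))
                (proj₁ (bend₂ W))
    where s = member ins

  -- pendant vertices hung on an induced matching T span double stars: the centres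
  -- v₁, v₂, v₃ of the three bends lie in T and form a cherry there
  no-walk-in-double-stars : ∀ {S T} → InducedMatching T → PendantOver S T →
                            ∀ W → ¬ Inside S W
  no-walk-in-double-stars matching pendant W ins =
    no-cherry-in-matching matching (bend₂ W)
      (centre-in pendant (bend₁ W) (s (# 0)) (s (# 1)) (s (# 2)))
      (centre-in pendant (bend₂ W) (s (# 1)) (s (# 2)) (s (# 3)))
      (centre-in pendant (bend₃ W) (s (# 2)) (s (# 3)) (s (# 4)))
    where s = member ins

  Separated : V → Pred V 0ℓ
  Separated w v = v ≢ w × ¬ w ~ v

  record CherryBesideWalk : Set where
    field
      {w₁ w₂ w₃} : V
      cherry     : Cherry w₁ w₂ w₃
      walk       : Walk5
      apart₁     : Inside (Separated w₁) walk
      apart₂     : Inside (Separated w₂) walk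
      apart₃     : Inside (Separated w₃) walk

  induced-P3+P5⇒cherry-beside-walk : InducedP3+P5 _~_ → CherryBesideWalk
  induced-P3+P5⇒cherry-beside-walk (f , f-injective , induced) = record
    { cherry = edge (# 0) (# 1) (λ ()) (inj₁ e01) , edge (# 1) (# 2) (λ ()) (inj₁ e12)
             , distinct (# 0) (# 2) (λ ())
    ; walk   = record
      { vertex = f ∘ (3 ↑ʳ_)
      ; bend₁  = edge (# 3) (# 4) (λ ()) (inj₁ e34) , edge (# 4) (# 5) (λ ()) (inj₁ e45)
               , distinct (# 3) (# 5) (λ ())
      ; bend₂  = edge (# 4) (# 5) (λ ()) (inj₁ e45) , edge (# 5) (# 6) (λ ()) (inj₁ e56)
               , distinct (# 4) (# 6) (λ ())
      ; bend₃  = edge (# 5) (# 6) (λ ()) (inj₁ e56) , edge (# 6) (# 7) (λ ()) (inj₁ e67)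
               , distinct (# 5) (# 7) (λ ()) }
    ; apart₁ = inside (separated (# 0))
    ; apart₂ = inside (separated (# 1))
    ; apart₃ = inside (separated (# 2)) }
    where
    edge : ∀ i j → i ≢ j → P3+P5-Adj i j → f i ~ f j
    edge i j i≢j = Equivalence.from (induced i j i≢j)

    distinct : ∀ i j → i ≢ j → f i ≢ f j
    distinct i j i≢j = i≢j ∘ f-injective

    separated : ∀ i j → Separated (f (i ↑ˡ 5)) (f (3 ↑ʳ j))
    separated i j =
      distinct _ _ (proj₁ (components-apart i j) ∘ sym) ,
      proj₂ (components-apart i j) ∘ Equivalence.to (induced _ _ (proj₁ (components-apart i j)))

data IsX {n m : ℕ} : Pred (V n m) 0ℓ where
  x-vtx    : ∀ i → IsX (x i)
  xbar-vtx : ∀ i → IsX (xbar i)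

data IsC {n m : ℕ} : Pred (V n m) 0ℓ where
  c-vtx  : ∀ j → IsC (c j)
  c'-vtx : ∀ j → IsC (c' j)

data IsA {n m : ℕ} : Pred (V n m) 0ℓ where
  a-vtx  : ∀ j p → IsA (a j p)
  a'-vtx : ∀ j p → IsA (a' j p)

pattern k₄ = k (suc (suc (suc zero)))
pattern k₅ = k (suc (suc (suc (suc zero))))

data IsCA {n m : ℕ} : Pred (V n m) 0ℓ where
  c-in  : ∀ j → IsCA (c j)
  c'-in : ∀ j → IsCA (c' j)
  a-in  : ∀ j p → IsCA (a j p)
  a'-in : ∀ j p → IsCA (a' j p)

data IsXAk₄ {n m : ℕ} : Pred (V n m) 0ℓ where
  x-in    : ∀ i → IsXAk₄ (x i)
  xbar-in : ∀ i → IsXAk₄ (xbar i)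
  a-in    : ∀ j p → IsXAk₄ (a j p)
  a'-in   : ∀ j p → IsXAk₄ (a' j p)
  k₄-in   : IsXAk₄ k₄

-- k ℓ with ℓ < 3 has the colour ℓ + 1 of clause position ℓ; the others have colours 4 and 5
data KColour : Fin 5 → Set where
  position : (p : Fin 3) → KColour (p ↑ˡ 2)
  four     : KColour (# 3)
  five     : KColour (# 4)

kColour : ∀ ℓ → KColour ℓ
kColour zero                         = position zero
kColour (suc zero)                   = position (suc zero)
kColour (suc (suc zero))             = position (suc (suc zero))
kColour (suc (suc (suc zero)))       = four
kColour (suc (suc (suc (suc zero)))) = five

pos : ∀ {n m} {u : V n m} → IsA u → Fin 3
pos (a-vtx _ p)  = p
pos (a'-vtx _ p) = p

clauseEnd : ∀ {n m} {u : V n m} → IsA u → V n m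
clauseEnd (a-vtx j _)  = c j
clauseEnd (a'-vtx j _) = c' j

A-determined : ∀ {n m} {u w : V n m} (U : IsA u) (W : IsA w) →
               clauseEnd U ≡ clauseEnd W → pos U ≡ pos W → u ≡ w
A-determined (a-vtx _ _)  (a-vtx _ _)  refl refl = refl
A-determined (a'-vtx _ _) (a'-vtx _ _) refl refl = refl

position-colour-absent : ∀ {p q : Fin 3} → p ≢ q → ℕ.suc (toℕ (p ↑ˡ 2)) ∉ ℕ.suc (toℕ q) ∷ 4 ∷ []
position-colour-absent {p} p≢q (here eq) =
  p≢q (toℕ-injective (trans (sym (toℕ-↑ˡ p 2)) (ℕ.suc-injective eq)))
position-colour-absent {zero}             _ (there (here ()))
position-colour-absent {suc zero}         _ (there (here ()))
position-colour-absent {suc (suc zero)}   _ (there (here ()))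
position-colour-absent                    _ (there (there ()))

five-absent : ∀ {q : Fin 3} → 5 ∉ ℕ.suc (toℕ q) ∷ 4 ∷ []
five-absent {zero}           (here ())
five-absent {suc zero}       (here ())
five-absent {suc (suc zero)} (here ())
five-absent (there (here ()))
five-absent (there (there ()))

module Structure {n m : ℕ} (cl : Clauses n m) where

  _~_ : V n m → V n m → Set
  _~_ = Adj cl

  open Walks _~_ swap public

  partner : ∀ {u : V n m} → IsX u → V n m
  partner (x-vtx i)    = xbar i
  partner (xbar-vtx i) = x i

  X-nbr-in-X : ∀ {u v : V n m} (U : IsX u) → IsX v → u ~ v → v ≡ partner U
  X-nbr-in-X (x-vtx _)    (xbar-vtx _) (inj₁ (x-xbar _)) = refl
  X-nbr-in-X (xbar-vtx _) (x-vtx _)    (inj₂ (x-xbar _)) = refl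
  X-nbr-in-X (x-vtx _)    (x-vtx _)    (inj₁ ())
  X-nbr-in-X (x-vtx _)    (x-vtx _)    (inj₂ ())
  X-nbr-in-X (x-vtx _)    (xbar-vtx _) (inj₂ ())
  X-nbr-in-X (xbar-vtx _) (x-vtx _)    (inj₁ ())
  X-nbr-in-X (xbar-vtx _) (xbar-vtx _) (inj₁ ())
  X-nbr-in-X (xbar-vtx _) (xbar-vtx _) (inj₂ ())

  X-matching : InducedMatching IsX
  X-matching U V W e e' = trans (X-nbr-in-X U V e) (sym (X-nbr-in-X U W e'))

  C-independent : Independent IsC
  C-independent (c-vtx _)  _          (inj₁ ())
  C-independent (c'-vtx _) _          (inj₁ ())
  C-independent _          (c-vtx _)  (inj₂ ())
  C-independent _          (c'-vtx _) (inj₂ ())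

  A-independent : Independent IsA
  A-independent (a-vtx _ _)  (a-vtx _ _)  (inj₁ ())
  A-independent (a-vtx _ _)  (a'-vtx _ _) (inj₁ ())
  A-independent (a'-vtx _ _) (a-vtx _ _)  (inj₁ ())
  A-independent (a'-vtx _ _) (a'-vtx _ _) (inj₁ ())
  A-independent (a-vtx _ _)  (a-vtx _ _)  (inj₂ ())
  A-independent (a-vtx _ _)  (a'-vtx _ _) (inj₂ ())
  A-independent (a'-vtx _ _) (a-vtx _ _)  (inj₂ ())
  A-independent (a'-vtx _ _) (a'-vtx _ _) (inj₂ ())

  X-C-complete : ∀ {u w : V n m} → IsX u → IsC w → u ~ w
  X-C-complete (x-vtx i)    (c-vtx j)  = inj₁ (x-c i j)
  X-C-complete (x-vtx i)    (c'-vtx j) = inj₁ (x-c' i j)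
  X-C-complete (xbar-vtx i) (c-vtx j)  = inj₁ (xbar-c i j)
  X-C-complete (xbar-vtx i) (c'-vtx j) = inj₁ (xbar-c' i j)

  A-nbr-in-CA : ∀ {u v : V n m} (U : IsA u) → IsCA v → u ~ v → v ≡ clauseEnd U
  A-nbr-in-CA (a-vtx _ _)  _  (inj₁ (a-c _ _))      = refl
  A-nbr-in-CA (a'-vtx _ _) _  (inj₁ (a'-c' _ _))    = refl
  A-nbr-in-CA (a-vtx _ _)  () (inj₂ (x-a _ _))
  A-nbr-in-CA (a-vtx _ _)  () (inj₂ (k-G _ _ _ _))
  A-nbr-in-CA (a'-vtx _ _) () (inj₂ (xbar-a' _ _))
  A-nbr-in-CA (a'-vtx _ _) () (inj₂ (k-G _ _ _ _))

  varEnd : ∀ {u : V n m} → IsA u → V n m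
  varEnd (a-vtx j p)  = x (cl j p)
  varEnd (a'-vtx j p) = xbar (cl j p)

  -- the only neighbour of an a-vertex in X ∪ A ∪ {k₄} is its X-end (k₄ misses colour 4)
  A-nbr-in-XAk₄ : ∀ {u v : V n m} (U : IsA u) → IsXAk₄ v → u ~ v → v ≡ varEnd U
  A-nbr-in-XAk₄ (a-vtx _ _)  _     (inj₂ (x-a _ _))        = refl
  A-nbr-in-XAk₄ (a'-vtx _ _) _     (inj₂ (xbar-a' _ _))    = refl
  A-nbr-in-XAk₄ (a-vtx _ _)  ()    (inj₁ (a-c _ _))
  A-nbr-in-XAk₄ (a'-vtx _ _) ()    (inj₁ (a'-c' _ _))
  A-nbr-in-XAk₄ (a-vtx _ _)  k₄-in (inj₂ (k-G _ _ _ ∉L)) = ⊥-elim (∉L (there (here refl)))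
  A-nbr-in-XAk₄ (a'-vtx _ _) k₄-in (inj₂ (k-G _ _ _ ∉L)) = ⊥-elim (∉L (there (here refl)))

  -- k₄ has no neighbour in X ∪ A ∪ {k₄}: colour 4 lies in every list of X ∪ A
  k₄-isolated : ∀ {u : V n m} → IsXAk₄ u → ¬ k₄ ~ u
  k₄-isolated (x-in _)    (inj₁ (k-G _ _ _ ∉L)) = ∉L (here refl)
  k₄-isolated (xbar-in _) (inj₁ (k-G _ _ _ ∉L)) = ∉L (here refl)
  k₄-isolated (a-in _ _)  (inj₁ (k-G _ _ _ ∉L)) = ∉L (there (here refl))
  k₄-isolated (a'-in _ _) (inj₁ (k-G _ _ _ ∉L)) = ∉L (there (here refl))
  k₄-isolated k₄-in       (inj₁ (k-k _ _ ℓ≢ℓ))  = ℓ≢ℓ refl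
  k₄-isolated k₄-in       (inj₂ (k-k _ _ ℓ≢ℓ))  = ℓ≢ℓ refl
  k₄-isolated k₄-in       (inj₁ (k-G _ _ () _))
  k₄-isolated k₄-in       (inj₂ (k-G _ _ () _))
  k₄-isolated (x-in _)    (inj₂ ())
  k₄-isolated (xbar-in _) (inj₂ ())
  k₄-isolated (a-in _ _)  (inj₂ ())
  k₄-isolated (a'-in _ _) (inj₂ ())

  CA-pendant-over-C : PendantOver IsCA IsC
  CA-pendant-over-C (c-in j)    = inj₁ (c-vtx j)
  CA-pendant-over-C (c'-in j)   = inj₁ (c'-vtx j)
  CA-pendant-over-C (a-in j p)  = inj₂ λ V W e e' →
    trans (A-nbr-in-CA (a-vtx j p) V e) (sym (A-nbr-in-CA (a-vtx j p) W e'))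
  CA-pendant-over-C (a'-in j p) = inj₂ λ V W e e' →
    trans (A-nbr-in-CA (a'-vtx j p) V e) (sym (A-nbr-in-CA (a'-vtx j p) W e'))

  XAk₄-pendant-over-X : PendantOver IsXAk₄ IsX
  XAk₄-pendant-over-X (x-in i)    = inj₁ (x-vtx i)
  XAk₄-pendant-over-X (xbar-in i) = inj₁ (xbar-vtx i)
  XAk₄-pendant-over-X (a-in j p)  = inj₂ λ V W e e' →
    trans (A-nbr-in-XAk₄ (a-vtx j p) V e) (sym (A-nbr-in-XAk₄ (a-vtx j p) W e'))
  XAk₄-pendant-over-X (a'-in j p) = inj₂ λ V W e e' →
    trans (A-nbr-in-XAk₄ (a'-vtx j p) V e) (sym (A-nbr-in-XAk₄ (a'-vtx j p) W e'))
  XAk₄-pendant-over-X k₄-in       = inj₂ λ V _ e _ → ⊥-elim (k₄-isolated V e)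

  k-adj : ∀ ℓ {u : V n m} → InG u → {False (ℕ.suc (toℕ ℓ) ∈? L u)} → k ℓ ~ u
  k-adj ℓ u∈G {absent} = inj₁ (k-G ℓ _ u∈G (toWitnessFalse absent))

  -- k₁, k₂, k₃ are complete to X (lists of X are {4, 5})
  kpos-X : ∀ (p : Fin 3) {u : V n m} → IsX u → k (p ↑ˡ 2) ~ u
  kpos-X zero             (x-vtx i)    = k-adj _ (inG-x i)
  kpos-X (suc zero)       (x-vtx i)    = k-adj _ (inG-x i)
  kpos-X (suc (suc zero)) (x-vtx i)    = k-adj _ (inG-x i)
  kpos-X zero             (xbar-vtx i) = k-adj _ (inG-xbar i)
  kpos-X (suc zero)       (xbar-vtx i) = k-adj _ (inG-xbar i)
  kpos-X (suc (suc zero)) (xbar-vtx i) = k-adj _ (inG-xbar i)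

  kpos-A : ∀ (p : Fin 3) {u : V n m} (U : IsA u) → p ≢ pos U → k (p ↑ˡ 2) ~ u
  kpos-A p (a-vtx j q)  p≢q = inj₁ (k-G _ _ (inG-a j q) (position-colour-absent p≢q))
  kpos-A p (a'-vtx j q) p≢q = inj₁ (k-G _ _ (inG-a' j q) (position-colour-absent p≢q))

  -- k₄ and k₅ are complete to C (lists of C are {1, 2, 3})
  k₄-C : ∀ {u : V n m} → IsC u → k₄ ~ u
  k₄-C (c-vtx j)  = k-adj _ (inG-c j)
  k₄-C (c'-vtx j) = k-adj _ (inG-c' j)

  k₅-C : ∀ {u : V n m} → IsC u → k₅ ~ u
  k₅-C (c-vtx j)  = k-adj _ (inG-c j)
  k₅-C (c'-vtx j) = k-adj _ (inG-c' j)

  k₅-A : ∀ {u : V n m} → IsA u → k₅ ~ u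
  k₅-A (a-vtx j q)  = inj₁ (k-G _ _ (inG-a j q) five-absent)
  k₅-A (a'-vtx j q) = inj₁ (k-G _ _ (inG-a' j q) five-absent)

  k-not-separated : ∀ {ℓ ℓ' : Fin 5} → ¬ Separated (k ℓ) (k ℓ')
  k-not-separated {ℓ} {ℓ'} (k≢k , not-adj) with ℓ ≟ ℓ'
  ... | yes refl = k≢k refl
  ... | no ℓ≢ℓ'  = not-adj (inj₁ (k-k ℓ ℓ' ℓ≢ℓ'))

  -- Everything separated from the given vertices lies in a set of one of the four
  -- shapes: C ∪ A (stars over C), X ∪ A ∪ {k₄} (double stars over X), X (a
  -- matching) or A (independent).

  -- k₁, k₂, k₃ see X
  kpos-separated : ∀ (p : Fin 3) → Separated (k (p ↑ˡ 2)) ⊆ IsCA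
  kpos-separated p {x i}    (_ , not-adj) = ⊥-elim (not-adj (kpos-X p (x-vtx i)))
  kpos-separated p {xbar i} (_ , not-adj) = ⊥-elim (not-adj (kpos-X p (xbar-vtx i)))
  kpos-separated p {c j}    _             = c-in j
  kpos-separated p {c' j}   _             = c'-in j
  kpos-separated p {a j q}  _             = a-in j q
  kpos-separated p {a' j q} _             = a'-in j q
  kpos-separated p {k ℓ}    sep           = ⊥-elim (k-not-separated sep)

  -- k₄ sees C
  k₄-separated : Separated k₄ ⊆ IsXAk₄
  k₄-separated {x i}    _             = x-in i
  k₄-separated {xbar i} _             = xbar-in i
  k₄-separated {c j}    (_ , not-adj) = ⊥-elim (not-adj (k₄-C (c-vtx j)))
  k₄-separated {c' j}   (_ , not-adj) = ⊥-elim (not-adj (k₄-C (c'-vtx j)))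
  k₄-separated {a j q}  _             = a-in j q
  k₄-separated {a' j q} _             = a'-in j q
  k₄-separated {k ℓ}    sep           = ⊥-elim (k-not-separated sep)

  -- k₅ sees C and A
  k₅-separated : Separated k₅ ⊆ IsX
  k₅-separated {x i}    _             = x-vtx i
  k₅-separated {xbar i} _             = xbar-vtx i
  k₅-separated {c j}    (_ , not-adj) = ⊥-elim (not-adj (k₅-C (c-vtx j)))
  k₅-separated {c' j}   (_ , not-adj) = ⊥-elim (not-adj (k₅-C (c'-vtx j)))
  k₅-separated {a j q}  (_ , not-adj) = ⊥-elim (not-adj (k₅-A (a-vtx j q)))
  k₅-separated {a' j q} (_ , not-adj) = ⊥-elim (not-adj (k₅-A (a'-vtx j q)))
  k₅-separated {k ℓ}    sep           = ⊥-elim (k-not-separated sep)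

  -- X and C see each other, k₁, k₂, k₃ see X and k₄, k₅ see C
  XC-separated : ∀ {u w : V n m} → IsX u → IsC w → Separated u ∩ Separated w ⊆ IsA
  XC-separated U W {x i}    (_ , _ , w≁) = ⊥-elim (w≁ (swap (X-C-complete (x-vtx i) W)))
  XC-separated U W {xbar i} (_ , _ , w≁) = ⊥-elim (w≁ (swap (X-C-complete (xbar-vtx i) W)))
  XC-separated U W {c j}    ((_ , u≁) , _) = ⊥-elim (u≁ (X-C-complete U (c-vtx j)))
  XC-separated U W {c' j}   ((_ , u≁) , _) = ⊥-elim (u≁ (X-C-complete U (c'-vtx j)))
  XC-separated U W {a j q}  _ = a-vtx j q
  XC-separated U W {a' j q} _ = a'-vtx j q
  XC-separated U W {k ℓ} ((_ , u≁) , _ , w≁) with kColour ℓ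
  ... | position p = ⊥-elim (u≁ (swap (kpos-X p U)))
  ... | four       = ⊥-elim (w≁ (swap (k₄-C W)))
  ... | five       = ⊥-elim (w≁ (swap (k₅-C W)))

  -- X sees C and k₁, k₂, k₃; k₅ sees A
  XA-separated : ∀ {u w : V n m} → IsX u → IsA w → Separated u ∩ Separated w ⊆ IsXAk₄
  XA-separated U W {x i}    _ = x-in i
  XA-separated U W {xbar i} _ = xbar-in i
  XA-separated U W {c j}    ((_ , u≁) , _) = ⊥-elim (u≁ (X-C-complete U (c-vtx j)))
  XA-separated U W {c' j}   ((_ , u≁) , _) = ⊥-elim (u≁ (X-C-complete U (c'-vtx j)))
  XA-separated U W {a j q}  _ = a-in j q
  XA-separated U W {a' j q} _ = a'-in j q
  XA-separated U W {k ℓ} ((_ , u≁) , _ , w≁) with kColour ℓ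
  ... | position p = ⊥-elim (u≁ (swap (kpos-X p U)))
  ... | four       = k₄-in
  ... | five       = ⊥-elim (w≁ (swap (k₅-A W)))

  -- a C-vertex with two a-neighbours at different positions: the clique vertex of
  -- any clause colour sees one of the two a-vertices
  CAA-separated : ∀ {u w w' : V n m} → IsC u → (W : IsA w) (W' : IsA w') → pos W ≢ pos W' →
                  Separated u ∩ Separated w ∩ Separated w' ⊆ IsCA
  CAA-separated U W W' _ {x i}    ((_ , u≁) , _) = ⊥-elim (u≁ (swap (X-C-complete (x-vtx i) U)))
  CAA-separated U W W' _ {xbar i} ((_ , u≁) , _) = ⊥-elim (u≁ (swap (X-C-complete (xbar-vtx i) U)))
  CAA-separated U W W' _ {c j}    _ = c-in j
  CAA-separated U W W' _ {c' j}   _ = c'-in j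
  CAA-separated U W W' _ {a j q}  _ = a-in j q
  CAA-separated U W W' _ {a' j q} _ = a'-in j q
  CAA-separated U W W' W≢W' {k ℓ} ((_ , u≁) , (_ , w≁) , _ , w'≁) with kColour ℓ
  ... | four       = ⊥-elim (u≁ (swap (k₄-C U)))
  ... | five       = ⊥-elim (u≁ (swap (k₅-C U)))
  ... | position p with p ≟ pos W
  ...   | yes refl = ⊥-elim (w'≁ (swap (kpos-A p W' W≢W')))
  ...   | no p≢pos = ⊥-elim (w≁ (swap (kpos-A p W p≢pos)))

  k-separates-no-walk : ∀ ℓ W → ¬ Inside (Separated (k ℓ)) W
  k-separates-no-walk ℓ W ins with kColour ℓ
  ... | position p = no-walk-in-stars C-independent CA-pendant-over-C W
                       (inside-⊆ (kpos-separated p) ins)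
  ... | four       = no-walk-in-double-stars X-matching XAk₄-pendant-over-X W
                       (inside-⊆ k₄-separated ins)
  ... | five       = no-walk-in-matching X-matching W (inside-⊆ k₅-separated ins)

  X-or-CA : ∀ {w} W → Inside (Separated w) W → IsX w ⊎ IsCA w
  X-or-CA {x i}    _ _   = inj₁ (x-vtx i)
  X-or-CA {xbar i} _ _   = inj₁ (xbar-vtx i)
  X-or-CA {c j}    _ _   = inj₂ (c-in j)
  X-or-CA {c' j}   _ _   = inj₂ (c'-in j)
  X-or-CA {a j p}  _ _   = inj₂ (a-in j p)
  X-or-CA {a' j p} _ _   = inj₂ (a'-in j p)
  X-or-CA {k ℓ}    W ins = ⊥-elim (k-separates-no-walk ℓ W ins)

  -- an X-vertex and a vertex of C ∪ A are never both separated from a walk: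
  -- with a C-vertex the walk would lie in A, with an a-vertex in X ∪ A ∪ {k₄}
  X-CA-separate-no-walk : ∀ {u w} → IsX u → IsCA w →
                          ∀ W → Inside (Separated u) W → Inside (Separated w) W → ⊥
  X-CA-separate-no-walk U (c-in j) W su sw =
    no-walk-in-independent A-independent W (inside-⊆ (XC-separated U (c-vtx j)) (inside-∩ su sw))
  X-CA-separate-no-walk U (c'-in j) W su sw =
    no-walk-in-independent A-independent W (inside-⊆ (XC-separated U (c'-vtx j)) (inside-∩ su sw))
  X-CA-separate-no-walk U (a-in j p) W su sw =
    no-walk-in-double-stars X-matching XAk₄-pendant-over-X W
      (inside-⊆ (XA-separated U (a-vtx j p)) (inside-∩ su sw))
  X-CA-separate-no-walk U (a'-in j p) W su sw =
    no-walk-in-double-stars X-matching XAk₄-pendant-over-X W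
      (inside-⊆ (XA-separated U (a'-vtx j p)) (inside-∩ su sw))

  C-nbr-in-CA : ∀ {u v} → IsC u → IsCA v → u ~ v → IsA v
  C-nbr-in-CA U (c-in j)    e = ⊥-elim (C-independent U (c-vtx j) e)
  C-nbr-in-CA U (c'-in j)   e = ⊥-elim (C-independent U (c'-vtx j) e)
  C-nbr-in-CA U (a-in j p)  _ = a-vtx j p
  C-nbr-in-CA U (a'-in j p) _ = a'-vtx j p

  -- a cherry inside C ∪ A is a-vertex – C-vertex – a-vertex, the two a-vertices at
  -- distinct positions of the same clause, so the walk would lie in C ∪ A
  CA-cherry-separates-no-walk : ∀ {w₁ w₂ w₃} → Cherry w₁ w₂ w₃ → IsCA w₁ → IsCA w₂ → IsCA w₃ → ∀ W →
    Inside (Separated w₁) W → Inside (Separated w₂) W → Inside (Separated w₃) W → ⊥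
  CA-cherry-separates-no-walk cherry@(e₁₂ , e₂₃ , w₁≢w₃) Y₁ Y₂ Y₃ W s₁ s₂ s₃ =
    no-walk-in-stars C-independent CA-pendant-over-C W
      (inside-⊆ (CAA-separated C₂ A₁ A₃ positions-differ) (inside-∩ s₂ (inside-∩ s₁ s₃)))
    where
    C₂ = centre-in CA-pendant-over-C cherry Y₁ Y₂ Y₃
    A₁ = C-nbr-in-CA C₂ Y₁ (swap e₁₂)
    A₃ = C-nbr-in-CA C₂ Y₃ e₂₃

    positions-differ : pos A₁ ≢ pos A₃
    positions-differ same-pos = w₁≢w₃ (A-determined A₁ A₃ same-end same-pos)
      where
      same-end : clauseEnd A₁ ≡ clauseEnd A₃
      same-end = trans (sym (A-nbr-in-CA A₁ Y₂ e₁₂)) (A-nbr-in-CA A₃ Y₂ (swap e₂₃))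

  no-cherry-beside-walk : ¬ CherryBesideWalk
  no-cherry-beside-walk b = by-classes (X-or-CA walk apart₁) (X-or-CA walk apart₂) (X-or-CA walk apart₃)
    where
    open CherryBesideWalk b

    by-classes : IsX w₁ ⊎ IsCA w₁ → IsX w₂ ⊎ IsCA w₂ → IsX w₃ ⊎ IsCA w₃ → ⊥
    by-classes (inj₁ X₁) (inj₁ X₂) (inj₁ X₃) = no-cherry-in-matching X-matching cherry X₁ X₂ X₃
    by-classes (inj₂ Y₁) (inj₂ Y₂) (inj₂ Y₃) =
      CA-cherry-separates-no-walk cherry Y₁ Y₂ Y₃ walk apart₁ apart₂ apart₃
    by-classes (inj₁ X₁) (inj₂ Y₂) _         = X-CA-separate-no-walk X₁ Y₂ walk apart₁ apart₂
    by-classes (inj₁ X₁) (inj₁ _)  (inj₂ Y₃) = X-CA-separate-no-walk X₁ Y₃ walk apart₁ apart₃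
    by-classes (inj₂ Y₁) (inj₁ X₂) _         = X-CA-separate-no-walk X₂ Y₁ walk apart₂ apart₁
    by-classes (inj₂ _)  (inj₂ Y₂) (inj₁ X₃) = X-CA-separate-no-walk X₃ Y₂ walk apart₃ apart₂

lemma9 : (n m : ℕ) (cl : Clauses n m) → DistinctClauses cl →
           ¬ InducedP3+P5 (Adj cl)
lemma9 n m cl _ = no-cherry-beside-walk ∘ induced-P3+P5⇒cherry-beside-walk
  where open Structure cl
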